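{- Let $k\geq1$, let $G_i=(V_i,E_i)$ ($1\le i\le k$) and $H=(V_H,E_H)$ be pairwise vertex-disjoint, connected graphs, each with at least two vertices, let $u_i\in V_i$ and $v_1,\dots,v_k\in V_H$ (not necessarily distinct), and let $J=(V_J,E_J)=G_{1,\ldots,k}\circ^{u_1,\dots,u_k}_{v_1,\dots,v_k}H$. Let $1\le i\le k$, $u'_i\in V_i\setminus\{u_i\}$ and $v'\in V_J\setminus V_i$. Then: (1) $u'_i$ is maximally distant from $u_i$ in $G_i$ if and only if $u'_i$ is maximally distant from $v_i$ in $J$; and if this holds, then $u'_i$ is maximally distant from $v'$ in $J$. (2) If $v'$ is maximally distant from $v_i$ in $J$, then $v'$ is maximally distant from $u'_i$ in $J$.
   Context: All graphs are finite, undirected and simple. In a connected graph $G$, $d_G(x,y)$ is the distance and $N_G(x)$ the set of neighbours of $x$. A vertex $u$ is maximally distant from a vertex $w$ in $G$ if there is no $v\in N_G(u)$ with $d_G(v,w)>d_G(u,w)$. The composed graph $J=G_{1,\ldots,k}\circ^{u_1,\dots,u_k}_{v_1,\dots,v_k}H$ has vertex set $(V_1\cup\dots\cup V_k\cup V_H)\setminus\{u_1,\dots,u_k\}$ and edge set $(E_1\cup\dots\cup E_k\cup E_H\cup\{\{x,v_i\}: x\in N_{G_i}(u_i),1\le i\le k\})\setminus\{\{x,u_i\}: x\in N_{G_i}(u_i),1\le i\le k\}$; i.e. $J$ is obtained by identifying each $u_i$ with $v_i$. -}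

module Defs where

open import Data.Nat using (ℕ; zero; suc; _≤_)
open import Data.Fin using (Fin)
open import Data.Bool using (Bool; T)
open import Data.Product using (Σ; _×_; _,_; ∃; proj₁)
open import Data.Sum using (_⊎_; inj₁; inj₂)
open import Data.Empty using (⊥)
open import Relation.Binary.PropositionalEquality using (_≡_)
open import Relation.Nullary using (¬_)

record Graph (n : ℕ) : Set where
  field
    adj    : Fin n → Fin n → Bool
    sym    : ∀ x y → adj x y ≡ adj y x
    irrefl : ∀ x → adj x x ≡ Bool.false
open Graph public

Edge : ∀ {n} → Graph n → Fin n → Fin n → Set
Edge G x y = T (adj G x y)

data Walk {A : Set} (R : A → A → Set) : A → A → ℕ → Set where
  nil  : ∀ {x} → Walk R x x zero
  cons : ∀ {x y z ℓ} → R x y → Walk R y z ℓ → Walk R x z (suc ℓ)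

Connected : {A : Set} → (A → A → Set) → Set
Connected {A} R = ∀ (x y : A) → ∃ λ ℓ → Walk R x y ℓ

IsDist : {A : Set} → (A → A → Set) → A → A → ℕ → Set
IsDist R x y d = Walk R x y d × (∀ ℓ → Walk R x y ℓ → d ≤ ℓ)

MaxDistant : {A : Set} → (A → A → Set) → A → A → Set
MaxDistant R u w =
  ∀ v → R u v → ∀ dv du → IsDist R v w dv → IsDist R u w du → dv ≤ du

record Rest (n : ℕ) (u : Fin n) : Set where
  constructor rest
  field
    pt  : Fin n
    .ne : ¬ (pt ≡ u)
open Rest public

-- Vertex set of the composed graph J: (V_1 ∪ … ∪ V_k ∪ V_H) ∖ {u_1,…,u_k}.
JV : (k : ℕ) (n : Fin k → ℕ) (u : (i : Fin k) → Fin (n i)) (m : ℕ) → Set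
JV k n u m = (Σ (Fin k) λ i → Rest (n i) (u i)) ⊎ Fin m

data JAdj {k : ℕ} {n : Fin k → ℕ} (G : (i : Fin k) → Graph (n i))
          (u : (i : Fin k) → Fin (n i)) {m : ℕ} (H : Graph m) (v : Fin k → Fin m)
          : JV k n u m → JV k n u m → Set where
  inG : ∀ i (x y : Rest (n i) (u i)) → Edge (G i) (pt x) (pt y) →
        JAdj G u H v (inj₁ (i , x)) (inj₁ (i , y))
  inH : ∀ a b → Edge H a b → JAdj G u H v (inj₂ a) (inj₂ b)
  GtoH : ∀ i (x : Rest (n i) (u i)) → Edge (G i) (pt x) (u i) →
         JAdj G u H v (inj₁ (i , x)) (inj₂ (v i))
  HtoG : ∀ i (x : Rest (n i) (u i)) → Edge (G i) (pt x) (u i) →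
         JAdj G u H v (inj₂ (v i)) (inj₁ (i , x))

InV : ∀ {k n u m} → Fin k → JV k n u m → Set
InV i (inj₁ (j , _)) = j ≡ i
InV i (inj₂ _) = ⊥

{-# OPTIONS --safe #-}
module Submission where

-- Idea: a walk in J from a vertex x of Gᵢ − uᵢ to a vertex outside Gᵢ must leave Gᵢ
-- through vᵢ, and the part inside Gᵢ is a walk to uᵢ in Gᵢ; conversely a walk to uᵢ in
-- Gᵢ lifts to a walk to vᵢ in J that is no longer. Hence dJ(x, z) = dGᵢ(x, uᵢ) + dJ(vᵢ, z)
-- for every such x and z, in particular dJ(x, vᵢ) = dGᵢ(x, uᵢ). All four claims follow by
-- comparing both sides of this identity at a vertex and at its neighbours; the only
-- exceptional case, v' = vᵢ in (2), is excluded because vᵢ has a neighbour in H and so is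
-- not maximally distant from itself.

open import Defs
open import Data.Nat using (ℕ; zero; suc; _+_; _≤_; z≤n; s≤s)
open import Data.Nat.Properties
  using (≤-trans; ≤-antisym; n≤0⇒n≡0; m≤m+n; m≤n+m; +-cancelˡ-≤; +-cancelʳ-≤; +-monoˡ-≤; +-monoʳ-≤; +-identityʳ)
open import Data.Fin using (Fin; punchIn)
open import Data.Fin.Properties using (punchInᵢ≢i) renaming (_≟_ to _≟ᶠ_)
open import Data.Bool using (T)
open import Data.Product using (_×_; _,_; ∃; ∃₂; proj₂)
open import Data.Sum using (inj₁; inj₂)
open import Data.Empty using (⊥-elim; ⊥-elim-irr)
open import Function.Bundles using (_⇔_; mk⇔)
open import Relation.Binary.PropositionalEquality using (_≡_; refl; subst) renaming (sym to ≡-sym)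
open import Relation.Nullary using (¬_; yes; no)

module _ {A : Set} {R : A → A → Set} where

  _++ʷ_ : ∀ {x y z a b} → Walk R x y a → Walk R y z b → Walk R x z (a + b)
  nil ++ʷ w′ = w′
  cons r w ++ʷ w′ = cons r (w ++ʷ w′)

  _∷ʳʷ_ : ∀ {x y z a} → Walk R x y a → R y z → Walk R x z (suc a)
  nil ∷ʳʷ r = cons r nil
  cons r w ∷ʳʷ r′ = cons r (w ∷ʳʷ r′)

  Walk-0⇒≡ : ∀ {x y} → Walk R x y 0 → x ≡ y
  Walk-0⇒≡ nil = refl

  Walk⇒neighbour : ∀ {x y ℓ} → Walk R x y ℓ → ¬ x ≡ y → ∃ (R x)
  Walk⇒neighbour nil x≢y = ⊥-elim (x≢y refl)
  Walk⇒neighbour (cons r _) _ = _ , r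

  IsDist-unique : ∀ {x y d d′} → IsDist R x y d → IsDist R x y d′ → d ≡ d′
  IsDist-unique (w , min) (w′ , min′) = ≤-antisym (min _ w′) (min′ _ w)

  IsDist-self : ∀ {x d} → IsDist R x x d → d ≡ 0
  IsDist-self (_ , min) = n≤0⇒n≡0 (min 0 nil)

  module _ (R-sym : ∀ {x y} → R x y → R y x) where

    reverseʷ : ∀ {x y a} → Walk R x y a → Walk R y x a
    reverseʷ nil = nil
    reverseʷ (cons r w) = reverseʷ w ∷ʳʷ R-sym r

    IsDist-sym : ∀ {x y d} → IsDist R x y d → IsDist R y x d
    IsDist-sym (w , min) = reverseʷ w , λ ℓ w′ → min ℓ (reverseʷ w′)

    ¬MaxDistant-self : ∀ {x y} → R x y → ¬ x ≡ y → ¬ MaxDistant R x x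
    ¬MaxDistant-self {x} {y} r x≢y md with md y r 1 0 (cons (R-sym r) nil , y-far) (nil , λ _ _ → z≤n)
      where
      y-far : ∀ ℓ → Walk R y x ℓ → 1 ≤ ℓ
      y-far zero w = ⊥-elim (x≢y (≡-sym (Walk-0⇒≡ w)))
      y-far (suc ℓ) _ = s≤s z≤n
    ... | ()

Edge-sym : ∀ {n} (G : Graph n) {x y} → Edge G x y → Edge G y x
Edge-sym G {x} {y} = subst T (Graph.sym G x y)

Edge-irrefl : ∀ {n} (G : Graph n) {x} → ¬ Edge G x x
Edge-irrefl G {x} e with subst T (irrefl G x) e
... | ()

neighbour-of : ∀ {m} (H : Graph m) → 2 ≤ m → Connected (Edge H) → (a : Fin m) → ∃ (Edge H a)
neighbour-of H (s≤s (s≤s _)) connected a =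
  Walk⇒neighbour (proj₂ (connected a (punchIn a Fin.zero))) (λ eq → punchInᵢ≢i a Fin.zero (≡-sym eq))

module Composed {k} {n : Fin k → ℕ} (G : (i : Fin k) → Graph (n i)) (u : (i : Fin k) → Fin (n i))
                {m} (H : Graph m) (v : Fin k → Fin m) where

  J : JV k n u m → JV k n u m → Set
  J = JAdj G u H v

  J-sym : ∀ {x y} → J x y → J y x
  J-sym (inG j x y e) = inG j y x (Edge-sym (G j) e)
  J-sym (inH a b e) = inH b a (Edge-sym H e)
  J-sym (GtoH j x e) = HtoG j x e
  J-sym (HtoG j x e) = GtoH j x e

  ¬MaxDistant-H-self : 2 ≤ m → Connected (Edge H) → ∀ a → ¬ MaxDistant J (inj₂ a) (inj₂ a)
  ¬MaxDistant-H-self two connected a with neighbour-of H two connected a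
  ... | b , e = ¬MaxDistant-self J-sym (inH a b e) λ { refl → Edge-irrefl H e }

  module Block (i : Fin k) where

    Gᵢ : Fin (n i) → Fin (n i) → Set
    Gᵢ = Edge (G i)

    hub : JV k n u m
    hub = inj₂ (v i)

    split-walk : ∀ {x z ℓ} → Walk J (inj₁ (i , x)) z ℓ → ¬ InV i z →
      ∃₂ λ a b → Walk Gᵢ (pt x) (u i) a × Walk J hub z b × a + b ≡ ℓ
    split-walk nil z∉Vᵢ = ⊥-elim (z∉Vᵢ refl)
    split-walk (cons (inG _ _ _ e) w) z∉Vᵢ with split-walk w z∉Vᵢ
    ... | a , b , wG , wJ , refl = suc a , b , cons e wG , wJ , refl
    split-walk (cons (GtoH _ _ e) w) _ = 1 , _ , cons e nil , w , refl

    -- The lift stops at the first visit of uᵢ, hence is possibly shorter.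
    lift-walk : ∀ {a} (x : Rest (n i) (u i)) → Walk Gᵢ (pt x) (u i) a →
      ∃ λ a′ → a′ ≤ a × Walk J (inj₁ (i , x)) hub a′
    lift-walk (rest x x≢u) nil = ⊥-elim-irr (x≢u refl)
    lift-walk x (cons {y = y} e w) with y ≟ᶠ u i
    ... | yes refl = 1 , s≤s z≤n , cons (GtoH i x e) nil
    ... | no y≢u with lift-walk (rest y y≢u) w
    ...   | a′ , a′≤a , w′ = suc a′ , s≤s a′≤a , cons (inG i x (rest y y≢u) e) w′

    dist-split : ∀ {z d} (x : Rest (n i) (u i)) → ¬ InV i z → IsDist J (inj₁ (i , x)) z d →
      ∃₂ λ a b → IsDist Gᵢ (pt x) (u i) a × IsDist J hub z b × a + b ≡ d
    dist-split {z} x z∉Vᵢ (w , min) with split-walk w z∉Vᵢ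
    ... | a , b , wG , wJ , refl = a , b , (wG , a-min) , (wJ , b-min) , refl
      where
      a-min : ∀ ℓ → Walk Gᵢ (pt x) (u i) ℓ → a ≤ ℓ
      a-min ℓ wG′ with lift-walk x wG′
      ... | a′ , a′≤ℓ , w′ = ≤-trans (+-cancelʳ-≤ b a a′ (min _ (w′ ++ʷ wJ))) a′≤ℓ
      b-min : ∀ ℓ → Walk J hub z ℓ → b ≤ ℓ
      b-min ℓ wJ′ with lift-walk x wG
      ... | a′ , a′≤a , w′ = +-cancelˡ-≤ a b ℓ (≤-trans (min _ (w′ ++ʷ wJ′)) (+-monoˡ-≤ ℓ a′≤a))

    dist-to-hub⇒ : ∀ {d} (x : Rest (n i) (u i)) → IsDist J (inj₁ (i , x)) hub d → IsDist Gᵢ (pt x) (u i) d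
    dist-to-hub⇒ x D with dist-split x (λ ()) D
    ... | a , b , DG , Dhub , refl rewrite IsDist-self Dhub | +-identityʳ a = DG

    dist-to-hub⇐ : ∀ {d} (x : Rest (n i) (u i)) → IsDist Gᵢ (pt x) (u i) d → IsDist J (inj₁ (i , x)) hub d
    dist-to-hub⇐ {d} x (wG , min) with lift-walk x wG
    ... | a′ , a′≤d , w′ = subst (Walk J _ hub) (≤-antisym a′≤d (d-min _ w′)) w′ , d-min
      where
      d-min : ∀ ℓ → Walk J (inj₁ (i , x)) hub ℓ → d ≤ ℓ
      d-min ℓ w with split-walk w (λ ())
      ... | a , b , wG′ , _ , refl = ≤-trans (min a wG′) (m≤m+n a b)

    neighbour-outside : ∀ {p w} → ¬ InV i p → ¬ p ≡ hub → J p w → ¬ InV i w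
    neighbour-outside p∉Vᵢ _ (inG _ _ _ _) = p∉Vᵢ
    neighbour-outside _ _ (inH _ _ _) = λ ()
    neighbour-outside _ _ (GtoH _ _ _) = λ ()
    neighbour-outside _ p≢hub (HtoG _ _ _) = λ { refl → p≢hub refl }

    module _ (x : Rest (n i) (u i)) where

      x̂ : JV k n u m
      x̂ = inj₁ (i , x)

      MaxDistant-hub⇒ : MaxDistant Gᵢ (pt x) (u i) → MaxDistant J x̂ hub
      MaxDistant-hub⇒ _ _ (GtoH _ _ _) _ _ Dv _ rewrite IsDist-self Dv = z≤n
      MaxDistant-hub⇒ md _ (inG _ _ y e) dv du Dv Du = md (pt y) e dv du (dist-to-hub⇒ y Dv) (dist-to-hub⇒ x Du)

      MaxDistant-hub⇐ : MaxDistant J x̂ hub → MaxDistant Gᵢ (pt x) (u i)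
      MaxDistant-hub⇐ md y e dv du Dv Du with y ≟ᶠ u i
      ... | yes refl rewrite IsDist-self Dv = z≤n
      ... | no y≢u = md _ (inG i x (rest y y≢u) e) dv du (dist-to-hub⇐ (rest y y≢u) Dv) (dist-to-hub⇐ x Du)

      MaxDistant-outside : ∀ {z} → ¬ InV i z → MaxDistant Gᵢ (pt x) (u i) → MaxDistant J x̂ z
      MaxDistant-outside z∉Vᵢ md w r dv du Dv Du with dist-split x z∉Vᵢ Du
      MaxDistant-outside z∉Vᵢ md _ (GtoH _ _ _) _ _ Dv Du | a , b , _ , Dhub , refl
        rewrite IsDist-unique Dv Dhub = m≤n+m b a
      MaxDistant-outside z∉Vᵢ md _ (inG _ _ y e) _ _ Dv Du | a , b , DG , Dhub , refl
        with dist-split y z∉Vᵢ Dv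
      ... | a′ , b′ , DG′ , Dhub′ , refl rewrite IsDist-unique Dhub′ Dhub =
        +-monoˡ-≤ b (md (pt y) e a′ a DG′ DG)

      MaxDistant-from-hub : ∀ {z} → ¬ InV i z → ¬ z ≡ hub → MaxDistant J z hub → MaxDistant J z x̂
      MaxDistant-from-hub z∉Vᵢ z≢hub md w r dv du Dv Du
        with dist-split x z∉Vᵢ (IsDist-sym J-sym Du)
           | dist-split x (neighbour-outside z∉Vᵢ z≢hub r) (IsDist-sym J-sym Dv)
      ... | a , b , DG , Dhub , refl | a′ , b′ , DG′ , Dhub′ , refl rewrite IsDist-unique DG′ DG =
        +-monoʳ-≤ a (md w r b′ b (IsDist-sym J-sym Dhub′) (IsDist-sym J-sym Dhub))

lemma4 : (k : ℕ) → 1 ≤ k →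
    (n : Fin k → ℕ) (G : (i : Fin k) → Graph (n i)) (m : ℕ) (H : Graph m) →
    (∀ i → 2 ≤ n i) → 2 ≤ m →
    (∀ i → Connected (Edge (G i))) → Connected (Edge H) →
    (u : (i : Fin k) → Fin (n i)) (v : Fin k → Fin m) →
    (i : Fin k) (u' : Fin (n i)) (u'≢u : ¬ (u' ≡ u i)) →
    (v' : JV k n u m) → ¬ InV i v' →
    ((MaxDistant (Edge (G i)) u' (u i) ⇔
        MaxDistant (JAdj G u H v) (inj₁ (i , rest u' u'≢u)) (inj₂ (v i)))
     × (MaxDistant (Edge (G i)) u' (u i) →
        MaxDistant (JAdj G u H v) (inj₁ (i , rest u' u'≢u)) v'))
    × (MaxDistant (JAdj G u H v) v' (inj₂ (v i)) →
       MaxDistant (JAdj G u H v) v' (inj₁ (i , rest u' u'≢u)))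
lemma4 k _ n G m H _ two _ connected u v i u' u'≢u v' v'∉Vᵢ =
  (mk⇔ (MaxDistant-hub⇒ x) (MaxDistant-hub⇐ x) , MaxDistant-outside x v'∉Vᵢ) ,
  λ md → MaxDistant-from-hub x v'∉Vᵢ (λ { refl → ¬MaxDistant-H-self two connected (v i) md }) md
  where
  open Composed G u H v
  open Block i
  x : Rest (n i) (u i)
  x = rest u' u'≢u
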